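{- (Termination.) The tableau system $\mathsf{TC}_{\mathsf{SCI}}$ is terminating: for every $\mathsf{SCI}$-formula $\varphi$ and every label $w$, every $\mathsf{TC}_{\mathsf{SCI}}$-tableau with root $w:\varphi$, built by applying the rules subject to the applicability restrictions, is finite (rule application cannot continue indefinitely).
   Context: Logic SCI. Fix a countably infinite set $\mathsf{AF}$ of atomic formulas. The set $\mathsf{FOR}$ of SCI-formulas is given by $\varphi ::= p \mid \neg\varphi \mid \varphi\to\varphi \mid \varphi\equiv\varphi$ with $p\in\mathsf{AF}$. Tableau system $\mathsf{TC}_{\mathsf{SCI}}$. Let $\mathsf{L}^+,\mathsf{L}^-$ be disjoint countably infinite sets of labels, $\mathsf{L}=\mathsf{L}^+\cup\mathsf{L}^-$; a label written $w^+$ lies in $\mathsf{L}^+$, $w^-$ in $\mathsf{L}^-$, an unsuperscripted label is arbitrary. A labelled formula is $w:\varphi$ with $w\in\mathsf{L},\varphi\in\mathsf{FOR}$. Equality statements $w=v$ and inequality statements $w\neq v$ may also occur. A tableau is a tree whose nodes carry labelled formulas, (in)equality statements or $\bot$; a branch is a root-to-leaf path, identified with the set of items on it. Rules (premises / alternative conclusion sets separated by $\mid$): Decomposition rules (all labels in the conclusions are fresh on the branch): $(\neg^+)$ $w^+:\neg\varphi$ / $v^-:\varphi$; $(\neg^-)$ $w^-:\neg\varphi$ / $v^+:\varphi$; $(\to^+)$ $w^+:\varphi\to\psi$ / $\{v^-:\varphi,u^-:\psi\}\mid\{v^-:\varphi,u^+:\psi\}\mid\{v^+:\varphi,u^+:\psi\}$;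 $(\to^-)$ $w^-:\varphi\to\psi$ / $\{v^+:\varphi,u^-:\psi\}$; $(\equiv^+)$ $w^+:\varphi\equiv\psi$ / $\{v^+:\varphi,u^+:\psi,v^+=u^+\}\mid\{v^-:\varphi,u^-:\psi,v^-=u^-\}$; $(\equiv^-)$ $w^-:\varphi\equiv\psi$ / $\{v^+:\varphi,u^+:\psi,v^+\neq u^+\}\mid\{v^+:\varphi,u^-:\psi\}\mid\{v^-:\varphi,u^+:\psi\}\mid\{v^-:\varphi,u^-:\psi,v^-\neq u^-\}$. Equality rules, where $\varphi\approx\psi$ abbreviates the three premises $w:\varphi$, $v:\psi$, $w=v$ for some labels $w,v$: $(\equiv^\neg)$ $\varphi\approx\psi$, $u:\neg\varphi$, $y:\neg\psi$ / $u=y$; $(\equiv^\to)$ $\varphi\approx\psi$, $\chi\approx\theta$, $x:\varphi\to\chi$, $z:\psi\to\theta$ / $x=z$; $(\equiv^\equiv)$ $\varphi\approx\psi$, $\chi\approx\theta$, $x:\varphi\equiv\chi$, $z:\psi\equiv\theta$ / $x=z$; $(\mathsf F)$ $w:\varphi$, $v:\varphi$ / $w=v$; $(\mathsf{sym})$ $w=v$ / $v=w$; $(\mathsf{tran})$ $w=v$, $v=u$ / $w=u$. Closure rules: $(\bot_1)$ $w=v$, $w\neq v$ / $\bot$; $(\bot_2)$ $w^+=v^-$ / $\bot$. Applicability restrictions: a decomposition rule may be applied to $w:\varphi$ on a branch only if it has not been applied to $w:\varphi$ on that branch before; an equality rule may be applied to premises on a branch only if its conclusion is not already on that branch; closure rules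 are applied eagerly, and a branch on which a closure rule has been applied (a closed branch) is not extended further. -}

module Defs where

open import Data.Nat using (ℕ)
open import Data.List using (List; []; _∷_; _++_)
open import Data.List.Membership.Propositional using (_∈_; _∉_)
open import Data.List.Relation.Unary.All using (All)
open import Data.List.Relation.Unary.Unique.Propositional using (Unique)
open import Data.Product using (_×_; _,_; Σ)
open import Relation.Nullary using (¬_)
open import Relation.Binary.PropositionalEquality using (_≡_)

infixr 6 _⇒_
infix 5 _≣_
data Formula : Set where
  atom : ℕ → Formula
  ¬̇_   : Formula → Formula
  _⇒_  : Formula → Formula → Formula
  _≣_  : Formula → Formula → Formula

-- Labels: L = L⁺ ∪ L⁻, two disjoint countably infinite sets

data Label : Set where
  pos : ℕ → Label
  neg : ℕ → Label

infix 4 _∶_ _≐_ _≠̇_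
data Item : Set where
  _∶_  : Label → Formula → Item
  _≐_  : Label → Label → Item
  _≠̇_  : Label → Label → Item
  ⊥̇    : Item

data Occurs (x : Label) : Item → Set where
  occ∶  : ∀ {φ} → Occurs x (x ∶ φ)
  occ≐ˡ : ∀ {v} → Occurs x (x ≐ v)
  occ≐ʳ : ∀ {w} → Occurs x (w ≐ x)
  occ≠ˡ : ∀ {v} → Occurs x (x ≠̇ v)
  occ≠ʳ : ∀ {w} → Occurs x (w ≠̇ x)

-- the state of a branch: the items on it (the branch, viewed as a set),
-- together with the record of which labelled formulas w:φ a decomposition
-- rule has already been applied to on this branch
record Branch : Set where
  constructor ⟨_,_⟩
  field
    items : List Item
    used  : List (Label × Formula)
open Branch public

Fresh : List Item → Label → Set
Fresh B x = ∀ {i} → i ∈ B → ¬ Occurs x i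

-- Decomposition rules.  Decomp w φ ls cs : one alternative conclusion set
-- cs of the rule for premise w:φ, whose (to-be-fresh) labels are ls.

data Decomp : Label → Formula → List Label → List Item → Set where
  ¬⁺  : ∀ {i φ} n →
        Decomp (pos i) (¬̇ φ) (neg n ∷ []) ((neg n ∶ φ) ∷ [])
  ¬⁻  : ∀ {i φ} n →
        Decomp (neg i) (¬̇ φ) (pos n ∷ []) ((pos n ∶ φ) ∷ [])
  ⇒⁺₁ : ∀ {i φ ψ} n m →
        Decomp (pos i) (φ ⇒ ψ) (neg n ∷ neg m ∷ []) ((neg n ∶ φ) ∷ (neg m ∶ ψ) ∷ [])
  ⇒⁺₂ : ∀ {i φ ψ} n m →
        Decomp (pos i) (φ ⇒ ψ) (neg n ∷ pos m ∷ []) ((neg n ∶ φ) ∷ (pos m ∶ ψ) ∷ [])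
  ⇒⁺₃ : ∀ {i φ ψ} n m →
        Decomp (pos i) (φ ⇒ ψ) (pos n ∷ pos m ∷ []) ((pos n ∶ φ) ∷ (pos m ∶ ψ) ∷ [])
  ⇒⁻  : ∀ {i φ ψ} n m →
        Decomp (neg i) (φ ⇒ ψ) (pos n ∷ neg m ∷ []) ((pos n ∶ φ) ∷ (neg m ∶ ψ) ∷ [])
  ≣⁺₁ : ∀ {i φ ψ} n m →
        Decomp (pos i) (φ ≣ ψ) (pos n ∷ pos m ∷ [])
               ((pos n ∶ φ) ∷ (pos m ∶ ψ) ∷ (pos n ≐ pos m) ∷ [])
  ≣⁺₂ : ∀ {i φ ψ} n m →
        Decomp (pos i) (φ ≣ ψ) (neg n ∷ neg m ∷ [])
               ((neg n ∶ φ) ∷ (neg m ∶ ψ) ∷ (neg n ≐ neg m) ∷ [])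
  ≣⁻₁ : ∀ {i φ ψ} n m →
        Decomp (neg i) (φ ≣ ψ) (pos n ∷ pos m ∷ [])
               ((pos n ∶ φ) ∷ (pos m ∶ ψ) ∷ (pos n ≠̇ pos m) ∷ [])
  ≣⁻₂ : ∀ {i φ ψ} n m →
        Decomp (neg i) (φ ≣ ψ) (pos n ∷ neg m ∷ []) ((pos n ∶ φ) ∷ (neg m ∶ ψ) ∷ [])
  ≣⁻₃ : ∀ {i φ ψ} n m →
        Decomp (neg i) (φ ≣ ψ) (neg n ∷ pos m ∷ []) ((neg n ∶ φ) ∷ (pos m ∶ ψ) ∷ [])
  ≣⁻₄ : ∀ {i φ ψ} n m →
        Decomp (neg i) (φ ≣ ψ) (neg n ∷ neg m ∷ [])
               ((neg n ∶ φ) ∷ (neg m ∶ ψ) ∷ (neg n ≠̇ neg m) ∷ [])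

_≈⟨_⟩_ : Formula → List Item → Formula → Set
φ ≈⟨ B ⟩ ψ = Σ Label λ w → Σ Label λ v → ((w ∶ φ) ∈ B) × ((v ∶ ψ) ∈ B) × ((w ≐ v) ∈ B)

data EqRule (B : List Item) : Item → Set where
  r≣¬  : ∀ {φ ψ u y} → φ ≈⟨ B ⟩ ψ → (u ∶ ¬̇ φ) ∈ B → (y ∶ ¬̇ ψ) ∈ B → EqRule B (u ≐ y)
  r≣⇒  : ∀ {φ ψ χ θ x z} → φ ≈⟨ B ⟩ ψ → χ ≈⟨ B ⟩ θ →
         (x ∶ φ ⇒ χ) ∈ B → (z ∶ ψ ⇒ θ) ∈ B → EqRule B (x ≐ z)
  r≣≣  : ∀ {φ ψ χ θ x z} → φ ≈⟨ B ⟩ ψ → χ ≈⟨ B ⟩ θ →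
         (x ∶ φ ≣ χ) ∈ B → (z ∶ ψ ≣ θ) ∈ B → EqRule B (x ≐ z)
  rF   : ∀ {φ w v} → (w ∶ φ) ∈ B → (v ∶ φ) ∈ B → EqRule B (w ≐ v)
  rsym : ∀ {w v} → (w ≐ v) ∈ B → EqRule B (v ≐ w)
  rtran : ∀ {w v u} → (w ≐ v) ∈ B → (v ≐ u) ∈ B → EqRule B (w ≐ u)

data Closable (B : List Item) : Set where
  ⊥₁ : ∀ {w v} → (w ≐ v) ∈ B → (w ≠̇ v) ∈ B → Closable B
  ⊥₂ : ∀ {i j} → (pos i ≐ neg j) ∈ B → Closable B

Closed : List Item → Set
Closed B = ⊥̇ ∈ B

-- Closure rules are eager: while a closure rule is applicable, no other
-- rule may be applied; closed branches are never extended.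

data Step : Branch → Branch → Set where
  close  : ∀ {B U} → ¬ Closed B → Closable B →
           Step ⟨ B , U ⟩ ⟨ ⊥̇ ∷ B , U ⟩
  decomp : ∀ {B U w φ ls cs} → ¬ Closed B → ¬ Closable B →
           (w ∶ φ) ∈ B → (w , φ) ∉ U →
           Decomp w φ ls cs → All (Fresh B) ls → Unique ls →
           Step ⟨ B , U ⟩ ⟨ cs ++ B , (w , φ) ∷ U ⟩
  equal  : ∀ {B U c} → ¬ Closed B → ¬ Closable B →
           EqRule B c → c ∉ B →
           Step ⟨ B , U ⟩ ⟨ c ∷ B , U ⟩

root : Label → Formula → Branch
root w φ = ⟨ (w ∶ φ) ∷ [] , [] ⟩

InfiniteRun : Label → Formula → Set
InfiniteRun w φ = Σ (ℕ → Branch) λ f →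
  (f 0 ≡ root w φ) × (∀ n → Step (f n) (f (Data.Nat.suc n)))

{-# OPTIONS --safe #-}
-- Two quantities measure the work left on a branch.  The pending size is the
-- total size of the labelled formulas not yet decomposed: a decomposition marks
-- its premise as used and only adds strictly smaller formulas, so it decreases.
-- Equality rules leave the pending size unchanged and only relate labels that
-- already occur on the branch; hence they draw from a finite stock of candidate
-- equalities, and the number of candidates still missing from the branch
-- decreases.  Closure ends the branch.  So every step of an open branch
-- decreases the pair of the two quantities lexicographically, and no run can
-- be infinite.
module Submission where

open import Defs
open import Data.List using (List; []; _∷_; _++_; map; filter; length; upTo; cartesianProductWith)
open import Data.List.Membership.Propositional using (_∈_; _∉_)
open import Data.List.Membership.Propositional.Properties using (∈-++⁺ˡ; ∈-++⁺ʳ; ∈-map⁺; ∈-upTo⁺; ∈-cartesianProductWith⁺)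
import Data.List.Membership.DecPropositional as DecMembership
open import Data.List.Properties using (map-++)
open import Data.List.Relation.Binary.Subset.Propositional using (_⊆_)
open import Data.List.Relation.Unary.Any using (here; there)
open import Data.Nat using (ℕ; suc; _+_; _⊔_; _≤_; _<_; z≤n; s≤s)
open import Data.Nat.Induction using (<-wellFounded)
open import Data.Nat.ListAction using (sum)
open import Data.Nat.ListAction.Properties using (sum-++)
open import Data.Nat.Properties
open import Algebra.Properties.CommutativeSemigroup +-commutativeSemigroup using (x∙yz≈y∙xz)
open import Data.Product using (_×_; _,_; ∃; ∃₂; uncurry)
open import Data.Product.Properties using (≡-dec)
open import Data.Product.Relation.Binary.Lex.Strict using (×-Lex; ×-wellFounded)
open import Data.Sum using (_⊎_; inj₁; inj₂)
open import Function using (_∘_)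
open import Induction.InfiniteDescent using (InfiniteDescendingSequence; InfiniteDescendingSequenceFrom; Descent; descent∧wf⇒empty)
open import Induction.WellFounded using (WellFounded)
open import Level using (0ℓ)
open import Relation.Binary.Core using (Rel)
open import Relation.Binary.Definitions using (DecidableEquality)
open import Relation.Binary.PropositionalEquality using (_≡_; refl; sym; trans; cong; cong₂)
open import Relation.Nullary using (¬_; ¬?; yes; no; contradiction)
open import Relation.Nullary.Decidable using (map′; _×-dec_)

wellFounded⇒¬infiniteDescent : ∀ {a r} {A : Set a} {_<_ : Rel A r} →
  WellFounded _<_ → (f : ℕ → A) → ¬ InfiniteDescendingSequence _<_ f
wellFounded⇒¬infiniteDescent {_<_ = _<_} wf f f↓ =
  descent∧wf⇒empty shift wf (f 0) (f , refl , f↓)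
  where
  shift : Descent _<_ (λ x → ∃ λ g → InfiniteDescendingSequenceFrom _<_ g x)
  shift (g , refl , g↓) = g 1 , g↓ 0 , g ∘ suc , refl , g↓ ∘ suc

label≟ : DecidableEquality Label
label≟ (pos m) (pos n) = map′ (cong pos) (λ { refl → refl }) (m ≟ n)
label≟ (neg m) (neg n) = map′ (cong neg) (λ { refl → refl }) (m ≟ n)
label≟ (pos _) (neg _) = no λ ()
label≟ (neg _) (pos _) = no λ ()

formula≟ : DecidableEquality Formula
formula≟ (atom m) (atom n) = map′ (cong atom) (λ { refl → refl }) (m ≟ n)
formula≟ (¬̇ φ) (¬̇ ψ) = map′ (cong ¬̇_) (λ { refl → refl }) (formula≟ φ ψ)
formula≟ (φ ⇒ χ) (ψ ⇒ θ) =
  map′ (uncurry (cong₂ _⇒_)) (λ { refl → refl , refl }) (formula≟ φ ψ ×-dec formula≟ χ θ)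
formula≟ (φ ≣ χ) (ψ ≣ θ) =
  map′ (uncurry (cong₂ _≣_)) (λ { refl → refl , refl }) (formula≟ φ ψ ×-dec formula≟ χ θ)
formula≟ (atom _) (¬̇ _)   = no λ ()
formula≟ (atom _) (_ ⇒ _) = no λ ()
formula≟ (atom _) (_ ≣ _) = no λ ()
formula≟ (¬̇ _) (atom _)   = no λ ()
formula≟ (¬̇ _) (_ ⇒ _)    = no λ ()
formula≟ (¬̇ _) (_ ≣ _)    = no λ ()
formula≟ (_ ⇒ _) (atom _) = no λ ()
formula≟ (_ ⇒ _) (¬̇ _)    = no λ ()
formula≟ (_ ⇒ _) (_ ≣ _)  = no λ ()
formula≟ (_ ≣ _) (atom _) = no λ ()
formula≟ (_ ≣ _) (¬̇ _)    = no λ ()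
formula≟ (_ ≣ _) (_ ⇒ _)  = no λ ()

item≟ : DecidableEquality Item
item≟ (w ∶ φ) (v ∶ ψ) = map′ (uncurry (cong₂ _∶_)) (λ { refl → refl , refl }) (label≟ w v ×-dec formula≟ φ ψ)
item≟ (w ≐ x) (v ≐ y) = map′ (uncurry (cong₂ _≐_)) (λ { refl → refl , refl }) (label≟ w v ×-dec label≟ x y)
item≟ (w ≠̇ x) (v ≠̇ y) = map′ (uncurry (cong₂ _≠̇_)) (λ { refl → refl , refl }) (label≟ w v ×-dec label≟ x y)
item≟ ⊥̇ ⊥̇ = yes refl
item≟ (_ ∶ _) (_ ≐ _)  = no λ ()
item≟ (_ ∶ _) (_ ≠̇ _)  = no λ ()
item≟ (_ ∶ _) ⊥̇        = no λ ()
item≟ (_ ≐ _) (_ ∶ _)  = no λ ()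
item≟ (_ ≐ _) (_ ≠̇ _)  = no λ ()
item≟ (_ ≐ _) ⊥̇        = no λ ()
item≟ (_ ≠̇ _) (_ ∶ _)  = no λ ()
item≟ (_ ≠̇ _) (_ ≐ _)  = no λ ()
item≟ (_ ≠̇ _) ⊥̇        = no λ ()
item≟ ⊥̇ (_ ∶ _)        = no λ ()
item≟ ⊥̇ (_ ≐ _)        = no λ ()
item≟ ⊥̇ (_ ≠̇ _)        = no λ ()

open DecMembership (≡-dec label≟ formula≟) using () renaming (_∈?_ to _∈ᵘ?_)
open DecMembership item≟ using () renaming (_∈?_ to _∈ⁱ?_)

size : Formula → ℕ
size (atom _) = 1
size (¬̇ φ)    = suc (size φ)
size (φ ⇒ ψ)  = suc (size φ + size ψ)
size (φ ≣ ψ)  = suc (size φ + size ψ)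

itemSize : Item → ℕ
itemSize (_ ∶ φ) = size φ
itemSize _       = 0

totalSize : List Item → ℕ
totalSize = sum ∘ map itemSize

m+[n+0]<1+m+n : ∀ m n → m + (n + 0) < suc (m + n)
m+[n+0]<1+m+n m n = s≤s (+-monoʳ-≤ m (≤-reflexive (+-identityʳ n)))

decomp-totalSize< : ∀ {w φ ls cs} → Decomp w φ ls cs → totalSize cs < size φ
decomp-totalSize< (¬⁺ _)                = s≤s (≤-reflexive (+-identityʳ _))
decomp-totalSize< (¬⁻ _)                = s≤s (≤-reflexive (+-identityʳ _))
decomp-totalSize< (⇒⁺₁ {φ = φ} {ψ} _ _) = m+[n+0]<1+m+n (size φ) (size ψ)
decomp-totalSize< (⇒⁺₂ {φ = φ} {ψ} _ _) = m+[n+0]<1+m+n (size φ) (size ψ)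
decomp-totalSize< (⇒⁺₃ {φ = φ} {ψ} _ _) = m+[n+0]<1+m+n (size φ) (size ψ)
decomp-totalSize< (⇒⁻  {φ = φ} {ψ} _ _) = m+[n+0]<1+m+n (size φ) (size ψ)
decomp-totalSize< (≣⁺₁ {φ = φ} {ψ} _ _) = m+[n+0]<1+m+n (size φ) (size ψ)
decomp-totalSize< (≣⁺₂ {φ = φ} {ψ} _ _) = m+[n+0]<1+m+n (size φ) (size ψ)
decomp-totalSize< (≣⁻₁ {φ = φ} {ψ} _ _) = m+[n+0]<1+m+n (size φ) (size ψ)
decomp-totalSize< (≣⁻₂ {φ = φ} {ψ} _ _) = m+[n+0]<1+m+n (size φ) (size ψ)
decomp-totalSize< (≣⁻₃ {φ = φ} {ψ} _ _) = m+[n+0]<1+m+n (size φ) (size ψ)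
decomp-totalSize< (≣⁻₄ {φ = φ} {ψ} _ _) = m+[n+0]<1+m+n (size φ) (size ψ)

Used : Set
Used = List (Label × Formula)

weight : Used → Item → ℕ
weight U (w ∶ φ) with (w , φ) ∈ᵘ? U
... | yes _ = 0
... | no _  = size φ
weight U _ = 0

pending : Used → List Item → ℕ
pending U = sum ∘ map (weight U)

weight≤itemSize : ∀ U i → weight U i ≤ itemSize i
weight≤itemSize U (w ∶ φ) with (w , φ) ∈ᵘ? U
... | yes _ = z≤n
... | no _  = ≤-refl
weight≤itemSize U (_ ≐ _) = z≤n
weight≤itemSize U (_ ≠̇ _) = z≤n
weight≤itemSize U ⊥̇       = z≤n

pending≤totalSize : ∀ U B → pending U B ≤ totalSize B
pending≤totalSize U []      = z≤n
pending≤totalSize U (i ∷ B) = +-mono-≤ (weight≤itemSize U i) (pending≤totalSize U B)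

pending-++ : ∀ U B C → pending U (B ++ C) ≡ pending U B + pending U C
pending-++ U B C = trans (cong sum (map-++ (weight U) B C)) (sum-++ (map (weight U) B) _)

weight-antitone : ∀ {U U′} → U ⊆ U′ → ∀ i → weight U′ i ≤ weight U i
weight-antitone {U} {U′} U⊆U′ (w ∶ φ) with (w , φ) ∈ᵘ? U′ | (w , φ) ∈ᵘ? U
... | yes _ | _       = z≤n
... | no _  | no _    = ≤-refl
... | no ∉U′ | yes ∈U = contradiction (U⊆U′ ∈U) ∉U′
weight-antitone U⊆U′ (_ ≐ _) = z≤n
weight-antitone U⊆U′ (_ ≠̇ _) = z≤n
weight-antitone U⊆U′ ⊥̇       = z≤n

pending-antitone : ∀ {U U′} → U ⊆ U′ → ∀ B → pending U′ B ≤ pending U B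
pending-antitone U⊆U′ []      = z≤n
pending-antitone U⊆U′ (i ∷ B) = +-mono-≤ (weight-antitone U⊆U′ i) (pending-antitone U⊆U′ B)

weight-used : ∀ {w φ U} → (w , φ) ∈ U → weight U (w ∶ φ) ≡ 0
weight-used {w} {φ} {U} ∈U with (w , φ) ∈ᵘ? U
... | yes _ = refl
... | no ∉U = contradiction ∈U ∉U

weight-unused : ∀ {w φ U} → (w , φ) ∉ U → weight U (w ∶ φ) ≡ size φ
weight-unused {w} {φ} {U} ∉U with (w , φ) ∈ᵘ? U
... | yes ∈U = contradiction ∈U ∉U
... | no _   = refl

pending-use : ∀ {w φ U B} → (w ∶ φ) ∈ B → (w , φ) ∉ U →
              size φ + pending ((w , φ) ∷ U) B ≤ pending U B
pending-use {w} {φ} {U} {_ ∷ B} (here refl) ∉U = begin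
  size φ + (weight U′ (w ∶ φ) + pending U′ B)
    ≡⟨ cong (λ n → size φ + (n + pending U′ B)) (weight-used {U = U′} (here refl)) ⟩
  size φ + pending U′ B
    ≤⟨ +-mono-≤ (≤-reflexive (sym (weight-unused ∉U))) (pending-antitone there B) ⟩
  weight U (w ∶ φ) + pending U B
    ∎
  where
  open ≤-Reasoning
  U′ = (w , φ) ∷ U
pending-use {w} {φ} {U} {i ∷ B} (there ∈B) ∉U = begin
  size φ + (weight U′ i + pending U′ B) ≡⟨ x∙yz≈y∙xz (size φ) (weight U′ i) (pending U′ B) ⟩
  weight U′ i + (size φ + pending U′ B) ≤⟨ +-mono-≤ (weight-antitone there i) (pending-use ∈B ∉U) ⟩
  weight U i + pending U B              ∎
  where
  open ≤-Reasoning
  U′ = (w , φ) ∷ U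

pending-decomp : ∀ {w φ ls cs U B} → (w ∶ φ) ∈ B → (w , φ) ∉ U → Decomp w φ ls cs →
                 pending ((w , φ) ∷ U) (cs ++ B) < pending U B
pending-decomp {w} {φ} {cs = cs} {U} {B} ∈B ∉U d = begin-strict
  pending U′ (cs ++ B)        ≡⟨ pending-++ U′ cs B ⟩
  pending U′ cs + pending U′ B ≤⟨ +-monoˡ-≤ _ (pending≤totalSize U′ cs) ⟩
  totalSize cs + pending U′ B <⟨ +-monoˡ-< _ (decomp-totalSize< d) ⟩
  size φ + pending U′ B       ≤⟨ pending-use ∈B ∉U ⟩
  pending U B                 ∎
  where
  open ≤-Reasoning
  U′ = (w , φ) ∷ U

index : Label → ℕ
index (pos n) = n
index (neg n) = n

itemBound : Item → ℕ
itemBound (w ∶ _)  = suc (index w)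
itemBound (w ≐ v)  = suc (index w) ⊔ suc (index v)
itemBound (w ≠̇ v)  = suc (index w) ⊔ suc (index v)
itemBound ⊥̇        = 0

labelBound : List Item → ℕ
labelBound []      = 0
labelBound (i ∷ B) = itemBound i ⊔ labelBound B

occurs-itemBound : ∀ {x i} → Occurs x i → index x < itemBound i
occurs-itemBound occ∶            = ≤-refl
occurs-itemBound (occ≐ˡ {v})     = m≤m⊔n _ (suc (index v))
occurs-itemBound {x} (occ≐ʳ {w}) = m≤n⊔m (suc (index w)) (suc (index x))
occurs-itemBound (occ≠ˡ {v})     = m≤m⊔n _ (suc (index v))
occurs-itemBound {x} (occ≠ʳ {w}) = m≤n⊔m (suc (index w)) (suc (index x))

occurs-labelBound : ∀ {x i B} → Occurs x i → i ∈ B → index x < labelBound B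
occurs-labelBound o (here refl) = ≤-trans (occurs-itemBound o) (m≤m⊔n _ _)
occurs-labelBound o (there ∈B)  = ≤-trans (occurs-labelBound o ∈B) (m≤n⊔m _ _)

eqRule-conclusion : ∀ {B c} → EqRule B c →
  ∃₂ λ x y → c ≡ (x ≐ y) × index x < labelBound B × index y < labelBound B
eqRule-conclusion (r≣¬ _ ∈u ∈y)     = _ , _ , refl , occurs-labelBound occ∶ ∈u , occurs-labelBound occ∶ ∈y
eqRule-conclusion (r≣⇒ _ _ ∈x ∈z)   = _ , _ , refl , occurs-labelBound occ∶ ∈x , occurs-labelBound occ∶ ∈z
eqRule-conclusion (r≣≣ _ _ ∈x ∈z)   = _ , _ , refl , occurs-labelBound occ∶ ∈x , occurs-labelBound occ∶ ∈z
eqRule-conclusion (rF ∈w ∈v)        = _ , _ , refl , occurs-labelBound occ∶ ∈w , occurs-labelBound occ∶ ∈v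
eqRule-conclusion (rsym ∈wv)        = _ , _ , refl , occurs-labelBound occ≐ʳ ∈wv , occurs-labelBound occ≐ˡ ∈wv
eqRule-conclusion (rtran ∈wv ∈vu)   = _ , _ , refl , occurs-labelBound occ≐ˡ ∈wv , occurs-labelBound occ≐ʳ ∈vu

labelsBelow : ℕ → List Label
labelsBelow K = map pos (upTo K) ++ map neg (upTo K)

∈-labelsBelow : ∀ {K} x → index x < K → x ∈ labelsBelow K
∈-labelsBelow (pos n) n<K = ∈-++⁺ˡ (∈-map⁺ pos (∈-upTo⁺ n<K))
∈-labelsBelow {K} (neg n) n<K = ∈-++⁺ʳ (map pos (upTo K)) (∈-map⁺ neg (∈-upTo⁺ n<K))

equalitiesBelow : ℕ → List Item
equalitiesBelow K = cartesianProductWith _≐_ (labelsBelow K) (labelsBelow K)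

missing : List Item → List Item → ℕ
missing B = length ∘ filter (λ c → ¬? (c ∈ⁱ? B))

missing-antitone : ∀ {B B′} → B ⊆ B′ → ∀ L → missing B′ L ≤ missing B L
missing-antitone B⊆B′ [] = z≤n
missing-antitone {B} {B′} B⊆B′ (c ∷ L) with c ∈ⁱ? B′ | c ∈ⁱ? B
... | yes _   | yes _ = missing-antitone B⊆B′ L
... | yes _   | no _  = m≤n⇒m≤1+n (missing-antitone B⊆B′ L)
... | no ∉B′ | yes ∈B = contradiction (B⊆B′ ∈B) ∉B′
... | no _    | no _  = s≤s (missing-antitone B⊆B′ L)

missing-strict : ∀ {B B′ c L} → B ⊆ B′ → c ∈ L → c ∈ B′ → c ∉ B → missing B′ L < missing B L
missing-strict {B} {B′} {c} {_ ∷ L} B⊆B′ (here refl) ∈B′ ∉B with c ∈ⁱ? B′ | c ∈ⁱ? B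
... | yes _  | no _  = s≤s (missing-antitone B⊆B′ L)
... | no ∉B′ | _     = contradiction ∈B′ ∉B′
... | yes _  | yes ∈B = contradiction ∈B ∉B
missing-strict {B} {B′} {_} {d ∷ L} B⊆B′ (there ∈L) ∈B′ ∉B with d ∈ⁱ? B′ | d ∈ⁱ? B
... | yes _   | yes _ = missing-strict B⊆B′ ∈L ∈B′ ∉B
... | yes _   | no _  = m<n⇒m<1+n (missing-strict B⊆B′ ∈L ∈B′ ∉B)
... | no ∉B′ | yes ∈B = contradiction (B⊆B′ ∈B) ∉B′
... | no _    | no _  = s≤s (missing-strict B⊆B′ ∈L ∈B′ ∉B)

missing-eqRule : ∀ {B c} → EqRule B c → c ∉ B →
  missing (c ∷ B) (equalitiesBelow (labelBound (c ∷ B))) < missing B (equalitiesBelow (labelBound B))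
missing-eqRule r ∉B with eqRule-conclusion r
... | x , y , refl , x<K , y<K rewrite m≤n⇒m⊔n≡n (⊔-lub x<K y<K) =
  missing-strict there (∈-cartesianProductWith⁺ _≐_ (∈-labelsBelow x x<K) (∈-labelsBelow y y<K)) (here refl) ∉B

measure : Branch → ℕ × ℕ
measure ⟨ B , U ⟩ = pending U B , missing B (equalitiesBelow (labelBound B))

_⊏_ : Rel (ℕ × ℕ) 0ℓ
_⊏_ = ×-Lex _≡_ _<_ _<_

step-open : ∀ {b b′} → Step b b′ → ¬ Closed (items b)
step-open (close ¬closed _)            = ¬closed
step-open (decomp ¬closed _ _ _ _ _ _) = ¬closed
step-open (equal ¬closed _ _ _)        = ¬closed

step-decreases : ∀ {b b′} → Step b b′ → Closed (items b′) ⊎ measure b′ ⊏ measure b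
step-decreases (close _ _)              = inj₁ (here refl)
step-decreases (decomp _ _ ∈B ∉U d _ _) = inj₂ (inj₁ (pending-decomp ∈B ∉U d))
-- Once c is seen to be an equality x ≐ y, its weight is 0 and the pending size is unchanged.
step-decreases (equal _ _ r ∉B) with eqRule-conclusion r
... | _ , _ , refl , _ = inj₂ (inj₂ (refl , missing-eqRule r ∉B))

theorem3 : (φ : Formula) (w : Label) → ¬ InfiniteRun w φ
theorem3 φ w (f , _ , step) =
  wellFounded⇒¬infiniteDescent (×-wellFounded <-wellFounded <-wellFounded) (measure ∘ f) descends
  where
  descends : InfiniteDescendingSequence _⊏_ (measure ∘ f)
  descends n with step-decreases (step n)
  ... | inj₁ closed = contradiction closed (step-open (step (suc n)))
  ... | inj₂ ⊏     = ⊏
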